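{- Let $0<\alpha<1$ and let $\Phi$ be a $k$-AND formula on variable set $X=\{x_1,\dots,x_n\}$ with clauses $\mathcal{C}=\{C_1,\dots,C_m\}$, each clause containing $k$ distinct variables. Suppose some truth assignment satisfies at least an $\alpha$ fraction of the clauses. Then there exist $f:X\to\{ -1,0,1\}$ and $g:\mathcal{C}\to\{ -1,0,1\}$ with $\vartheta(f,g)\ge k/2$.
   Context: For a clause $C_j$ and variable $x_i$, set $a_{ji}=1/m$ if $x_i$ appears un-negated in $C_j$, $a_{ji}=-1/m$ if it appears negated, and $a_{ji}=0$ otherwise. For $f:X\to\{ -1,0,1\}$ and $g:\mathcal{C}\to\{ -1,0,1\}$ let $\mu_f=\frac1n\sum_{i}|f(x_i)|$, $\mu_g=\frac1m\sum_j|g(C_j)|$ and \[\vartheta(f,g)=\frac{\sum_{i,j}a_{ji}f(x_i)g(C_j)}{\alpha\mu_f+\mu_g}\] (defined when the denominator is positive). A clause is satisfied by a truth assignment if all its literals are true.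
   Formalization: The parameter α ranges over the rationals strictly between 0 and 1. -}

module Defs where

open import Data.Nat as ℕ using (ℕ; zero; suc)
open import Data.Integer using (ℤ; +_)
open import Data.Fin using (Fin; _≟_)
import Data.Fin as F
open import Data.Bool using (Bool; true; false; if_then_else_)
open import Data.Product using (_×_; _,_; proj₁; proj₂; ∃)
open import Data.List using (List; []; _∷_)
open import Data.Rational using (ℚ; 0ℚ; 1ℚ; _+_; _*_; _÷_; _/_; -_; ∣_∣; _<_; positive)
open import Data.Rational.Properties using (pos⇒nonZero)
open import Relation.Nullary using (yes; no; does)
open import Relation.Binary.PropositionalEquality using (_≡_)
open import Function.Definitions using (Injective)

Σℚ : (n : ℕ) → (Fin n → ℚ) → ℚ
Σℚ zero    h = 0ℚ
Σℚ (suc n) h = h F.zero + Σℚ n (λ i → h (F.suc i))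

count : (n : ℕ) → (Fin n → Bool) → ℕ
count zero    p = 0
count (suc n) p = (if p F.zero then 1 else 0) ℕ.+ count n (λ i → p (F.suc i))

anyFin : (k : ℕ) → (Fin k → Bool) → Bool
anyFin zero    p = false
anyFin (suc k) p = if p F.zero then true else anyFin k (λ i → p (F.suc i))

allFin : (k : ℕ) → (Fin k → Bool) → Bool
allFin zero    p = true
allFin (suc k) p = if p F.zero then allFin k (λ i → p (F.suc i)) else false

-- A literal over variables x_0..x_{n-1}: (variable index, polarity),
-- polarity true = un-negated, false = negated.
Literal : ℕ → Set
Literal n = Fin n × Bool

Clause : ℕ → ℕ → Set
Clause n k = Fin k → Literal n

Formula : ℕ → ℕ → ℕ → Set
Formula n m k = Fin m → Clause n k

DistinctVars : ∀ {n m k} → Formula n m k → Set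
DistinctVars {n} {m} {k} Φ = (j : Fin m) → Injective _≡_ _≡_ (λ l → proj₁ (Φ j l))

boolEq : Bool → Bool → Bool
boolEq true  true  = true
boolEq false false = true
boolEq _     _     = false

Assignment : ℕ → Set
Assignment n = Fin n → Bool

litTrue : ∀ {n} → Assignment n → Literal n → Bool
litTrue σ (i , b) = boolEq (σ i) b

satisfies : ∀ {n k} → Assignment n → Clause n k → Bool
satisfies {k = k} σ C = allFin k (λ l → litTrue σ (C l))

numSat : ∀ {n m k} → Formula n m k → Assignment n → ℕ
numSat {m = m} Φ σ = count m (λ j → satisfies σ (Φ j))

nq : ℕ → ℚ
nq n = (+ n) / 1

coeff : ∀ {n m k} .{{_ : ℕ.NonZero m}} → Formula n m k → Fin m → Fin n → ℚ
coeff {m = m} {k = k} Φ j i =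
  if anyFin k (λ l → does (proj₁ (Φ j l) ≟ i) Data.Bool.∧ boolEq (proj₂ (Φ j l)) true)
  then (+ 1) / m
  else (if anyFin k (λ l → does (proj₁ (Φ j l) ≟ i) Data.Bool.∧ boolEq (proj₂ (Φ j l)) false)
        then - ((+ 1) / m)
        else 0ℚ)
  where import Data.Bool

data Tri : Set where
  neg zer pos : Tri

val : Tri → ℚ
val neg = - 1ℚ
val zer = 0ℚ
val pos = 1ℚ

μ : (n : ℕ) .{{_ : ℕ.NonZero n}} → (Fin n → Tri) → ℚ
μ n f = ((+ 1) / n) * Σℚ n (λ i → ∣ val (f i) ∣)

thetaNum : ∀ {n m k} .{{_ : ℕ.NonZero m}} → Formula n m k →
           (Fin n → Tri) → (Fin m → Tri) → ℚ
thetaNum {n} {m} Φ f g = Σℚ n (λ i → Σℚ m (λ j → coeff Φ j i * val (f i) * val (g j)))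

thetaDen : (n m : ℕ) .{{_ : ℕ.NonZero n}} .{{_ : ℕ.NonZero m}} → ℚ →
           (Fin n → Tri) → (Fin m → Tri) → ℚ
thetaDen n m α f g = α * μ n f + μ m g

ϑ : ∀ {n m k} .{{_ : ℕ.NonZero n}} .{{_ : ℕ.NonZero m}} (α : ℚ) → Formula n m k →
    (f : Fin n → Tri) → (g : Fin m → Tri) → 0ℚ < thetaDen n m α f g → ℚ
ϑ {n} {m} α Φ f g d>0 =
  (thetaNum Φ f g ÷ thetaDen n m α f g) {{pos⇒nonZero (thetaDen n m α f g) {{positive d>0}}}}

module Submission where

-- Fix an assignment σ satisfying S ≥ αm clauses and take
--   f(x_i) = ±1 according to σ(x_i),   g(C_j) = 1 if σ satisfies C_j, else 0.
-- Every literal of a satisfied clause is true, so a_{ji} f(x_i) = 1/m for each of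
-- its k (distinct) variables and 0 elsewhere: the row of a satisfied clause sums to
-- k/m.  Hence the numerator of ϑ is k·S/m, while μ_f = 1 and μ_g = S/m, so the
-- denominator is α + S/m.  Since α ≤ S/m, we get
--   (k/2)·(α + S/m) ≤ (k/2)·(2·S/m) = k·S/m,  i.e.  ϑ(f,g) ≥ k/2.

open import Defs
open import Data.Nat using (ℕ; NonZero)
open import Data.Integer using (+_)
open import Data.Rational using (ℚ; 0ℚ; 1ℚ; _*_; _/_; _<_; _≤_)
open import Data.Fin using (Fin)
open import Data.Product using (Σ; ∃; ∃-syntax)

open import Data.Nat as ℕ using (zero; suc)
import Data.Nat.Properties as ℕ
open import Data.Integer as ℤ using (ℤ)
open import Data.Integer.Tactic.RingSolver using (solve-∀)
open import Data.Rational using (_+_; -_; _÷_; ∣_∣; fromℚᵘ; NonNegative; Positive; positive)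
open import Data.Rational.Properties
import Data.Rational.Unnormalised as ℚᵘ
import Data.Rational.Unnormalised.Properties as ℚᵘ
open import Data.Rational.Solver using (module +-*-Solver)
import Data.Fin as F
open import Data.Fin.Properties using (suc-injective)
open import Data.Bool using (Bool; true; false; if_then_else_; _∧_; not)
open import Data.Product using (_,_; proj₁; proj₂)
open import Relation.Nullary using (yes; no; does)
open import Function.Definitions using (Injective)
open import Relation.Binary.PropositionalEquality
open import Algebra.Bundles using (CommutativeMonoid)
open import Algebra.Properties.CommutativeSemigroup
  (CommutativeMonoid.commutativeSemigroup +-0-commutativeMonoid)
  using () renaming (interchange to +-interchange)

-- The rational a/(1+d) is `fromℚᵘ` of the unnormalised fraction, and
-- `fromℚᵘ` is a homomorphism, so identities between fractions reduce to identities
-- between their (integer) cross products.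

fromℚᵘ-homo-+ : ∀ p q → fromℚᵘ (p ℚᵘ.+ q) ≡ fromℚᵘ p + fromℚᵘ q
fromℚᵘ-homo-+ p q = toℚᵘ-injective (ℚᵘ.≃-trans (toℚᵘ-fromℚᵘ (p ℚᵘ.+ q)) (ℚᵘ.≃-sym
  (ℚᵘ.≃-trans (toℚᵘ-homo-+ (fromℚᵘ p) (fromℚᵘ q))
              (ℚᵘ.+-cong (toℚᵘ-fromℚᵘ p) (toℚᵘ-fromℚᵘ q)))))

fromℚᵘ-homo-* : ∀ p q → fromℚᵘ (p ℚᵘ.* q) ≡ fromℚᵘ p * fromℚᵘ q
fromℚᵘ-homo-* p q = toℚᵘ-injective (ℚᵘ.≃-trans (toℚᵘ-fromℚᵘ (p ℚᵘ.* q)) (ℚᵘ.≃-sym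
  (ℚᵘ.≃-trans (toℚᵘ-homo-* (fromℚᵘ p) (fromℚᵘ q))
              (ℚᵘ.*-cong (toℚᵘ-fromℚᵘ p) (toℚᵘ-fromℚᵘ q)))))

nq-suc : ∀ a → nq (suc a) ≡ 1ℚ + nq a
nq-suc a = trans (fromℚᵘ-cong {ℚᵘ.mkℚᵘ (+ suc a) 0} {ℚᵘ.1ℚᵘ ℚᵘ.+ ℚᵘ.mkℚᵘ (+ a) 0} (ℚᵘ.*≡* (cross (+ a))))
                 (fromℚᵘ-homo-+ ℚᵘ.1ℚᵘ (ℚᵘ.mkℚᵘ (+ a) 0))
  where
  cross : ∀ (x : ℤ) → (+ 1 ℤ.+ x) ℤ.* + 1 ≡ (+ 1 ℤ.* + 1 ℤ.+ x ℤ.* + 1) ℤ.* + 1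
  cross = solve-∀

recip-cancel : ∀ m .{{_ : NonZero m}} → ((+ 1) / m) * nq m ≡ 1ℚ
recip-cancel (suc m) = trans (sym (fromℚᵘ-homo-* (ℚᵘ.mkℚᵘ (+ 1) m) (ℚᵘ.mkℚᵘ (+ suc m) 0)))
                             (fromℚᵘ-cong {ℚᵘ.mkℚᵘ (+ 1) m ℚᵘ.* ℚᵘ.mkℚᵘ (+ suc m) 0} {ℚᵘ.1ℚᵘ} (ℚᵘ.*≡* (cross (+ suc m))))
  where
  cross : ∀ (x : ℤ) → (+ 1 ℤ.* x) ℤ.* + 1 ≡ + 1 ℤ.* (x ℤ.* + 1)
  cross = solve-∀

halves : ∀ k → (+ k) / 2 + (+ k) / 2 ≡ nq k
halves k = trans (sym (fromℚᵘ-homo-+ (ℚᵘ.mkℚᵘ (+ k) 1) (ℚᵘ.mkℚᵘ (+ k) 1)))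
                 (fromℚᵘ-cong {ℚᵘ.mkℚᵘ (+ k) 1 ℚᵘ.+ ℚᵘ.mkℚᵘ (+ k) 1} {ℚᵘ.mkℚᵘ (+ k) 0} (ℚᵘ.*≡* (cross (+ k))))
  where
  cross : ∀ (x : ℤ) → (x ℤ.* + 2 ℤ.+ x ℤ.* + 2) ℤ.* + 1 ≡ x ℤ.* (+ 2 ℤ.* + 2)
  cross = solve-∀

Σ-cong : ∀ n {u v : Fin n → ℚ} → (∀ i → u i ≡ v i) → Σℚ n u ≡ Σℚ n v
Σ-cong zero    e = refl
Σ-cong (suc n) e = cong₂ _+_ (e F.zero) (Σ-cong n (λ i → e (F.suc i)))

Σ-zero : ∀ n → Σℚ n (λ _ → 0ℚ) ≡ 0ℚ
Σ-zero zero    = refl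
Σ-zero (suc n) = cong (_+_ 0ℚ) (Σ-zero n)

Σ-+ : ∀ n (u v : Fin n → ℚ) → Σℚ n (λ i → u i + v i) ≡ Σℚ n u + Σℚ n v
Σ-+ zero    u v = refl
Σ-+ (suc n) u v = trans (cong (_+_ (u F.zero + v F.zero)) (Σ-+ n _ _))
                        (+-interchange (u F.zero) (v F.zero) _ _)

Σ-swap : ∀ n m (h : Fin n → Fin m → ℚ) →
         Σℚ n (λ i → Σℚ m (h i)) ≡ Σℚ m (λ j → Σℚ n (λ i → h i j))
Σ-swap zero    m h = sym (Σ-zero m)
Σ-swap (suc n) m h = trans (cong (_+_ (Σℚ m (h F.zero))) (Σ-swap n m (λ i → h (F.suc i))))
                           (sym (Σ-+ m (h F.zero) _))

Σ-*ʳ : ∀ n (u : Fin n → ℚ) c → Σℚ n (λ i → u i * c) ≡ Σℚ n u * c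
Σ-*ʳ zero    u c = sym (*-zeroˡ c)
Σ-*ʳ (suc n) u c = trans (cong (_+_ (u F.zero * c)) (Σ-*ʳ n _ c))
                         (sym (*-distribʳ-+ c (u F.zero) _))

Σ-indicator : ∀ n (p : Fin n → Bool) c →
              Σℚ n (λ i → if p i then c else 0ℚ) ≡ c * nq (count n p)
Σ-indicator zero    p c = sym (*-zeroʳ c)
Σ-indicator (suc n) p c with p F.zero
... | false = trans (+-identityˡ _) (Σ-indicator n _ c)
... | true  = begin
  c + Σℚ n _                   ≡⟨ cong (_+_ c) (Σ-indicator n _ c) ⟩
  c + c * nq N                 ≡⟨ cong (_+ c * nq N) (sym (*-identityʳ c)) ⟩
  c * 1ℚ + c * nq N            ≡⟨ sym (*-distribˡ-+ c 1ℚ (nq N)) ⟩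
  c * (1ℚ + nq N)              ≡⟨ cong (c *_) (sym (nq-suc N)) ⟩
  c * nq (suc N)               ∎
  where
  open ≡-Reasoning
  N = count n (λ i → p (F.suc i))

Σ-one : ∀ n → Σℚ n (λ _ → 1ℚ) ≡ nq n
Σ-one zero    = refl
Σ-one (suc n) = trans (cong (_+_ 1ℚ) (Σ-one n)) (sym (nq-suc n))

-- A count splits over a disjoint union of predicates, a singleton has
-- one element, and hence the image of an injective map Fin k → Fin n has k elements
-- (this is where the distinctness of the variables of a clause enters).

count-∨ : ∀ n (a b : Fin n → Bool) → (∀ i → a i ≡ true → b i ≡ false) →
          count n (λ i → if a i then true else b i) ≡ count n a ℕ.+ count n b
count-∨ zero    a b disj = refl
count-∨ (suc n) a b disj with a F.zero in ea | b F.zero in eb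
... | true  | true  with () ← trans (sym eb) (disj F.zero ea)
... | true  | false = cong suc (count-∨ n _ _ (λ i → disj (F.suc i)))
... | false | true  = trans (cong suc (count-∨ n _ _ (λ i → disj (F.suc i))))
                           (sym (ℕ.+-suc _ _))
... | false | false = count-∨ n _ _ (λ i → disj (F.suc i))

count-false : ∀ n → count n (λ _ → false) ≡ 0
count-false zero    = refl
count-false (suc n) = count-false n

count-singleton : ∀ n (x : Fin n) → count n (λ i → does (x F.≟ i)) ≡ 1
count-singleton (suc n) F.zero    = cong suc (count-false n)
count-singleton (suc n) (F.suc x) = count-singleton n x

anyFin-cong : ∀ k {p q : Fin k → Bool} → (∀ l → p l ≡ q l) → anyFin k p ≡ anyFin k q
anyFin-cong zero    e = refl
anyFin-cong (suc k) e rewrite e F.zero = cong (if _ then true else_) (anyFin-cong k (λ l → e (F.suc l)))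

anyFin-false : ∀ k → anyFin k (λ _ → false) ≡ false
anyFin-false zero    = refl
anyFin-false (suc k) = anyFin-false k

allFin-elim : ∀ k (p : Fin k → Bool) → allFin k p ≡ true → ∀ l → p l ≡ true
allFin-elim (suc k) p all l with p F.zero in e0
allFin-elim (suc k) p all F.zero    | true = e0
allFin-elim (suc k) p all (F.suc l) | true = allFin-elim k _ all l

count-image : ∀ n k (v : Fin k → Fin n) → Injective _≡_ _≡_ v →
              count n (λ i → anyFin k (λ l → does (v l F.≟ i))) ≡ k
count-image n zero    v inj = count-false n
count-image n (suc k) v inj = begin
  count n (λ i → if does (v F.zero F.≟ i) then true else rest i)
    ≡⟨ count-∨ n _ rest disjoint ⟩
  count n (λ i → does (v F.zero F.≟ i)) ℕ.+ count n rest
    ≡⟨ cong₂ ℕ._+_ (count-singleton n (v F.zero))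
                   (count-image n k (λ l → v (F.suc l)) (λ e → suc-injective (inj e))) ⟩
  suc k ∎
  where
  open ≡-Reasoning
  rest : Fin n → Bool
  rest i = anyFin k (λ l → does (v (F.suc l) F.≟ i))
  disjoint : ∀ i → does (v F.zero F.≟ i) ≡ true → rest i ≡ false
  disjoint i hit with v F.zero F.≟ i
  ... | yes refl = trans (anyFin-cong k missed) (anyFin-false k)
    where
    missed : ∀ l → does (v (F.suc l) F.≟ v F.zero) ≡ false
    missed l with v (F.suc l) F.≟ v F.zero
    ... | yes e with () ← inj e
    ... | no _  = refl

occurs : ∀ {n k} → Clause n k → Fin n → Bool
occurs {k = k} C i = anyFin k (λ l → does (proj₁ (C l) F.≟ i))

occursWith : ∀ {n k} → Clause n k → Fin n → Bool → Bool
occursWith {k = k} C i b = anyFin k (λ l → does (proj₁ (C l) F.≟ i) ∧ boolEq (proj₂ (C l)) b)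

boolEq-sound : ∀ x y → boolEq x y ≡ true → x ≡ y
boolEq-sound true  true  _ = refl
boolEq-sound false false _ = refl

boolEq-refl : ∀ x → boolEq x x ≡ true
boolEq-refl true  = refl
boolEq-refl false = refl

boolEq-not : ∀ x → boolEq x (not x) ≡ false
boolEq-not true  = refl
boolEq-not false = refl

literal-true : ∀ {n k} (σ : Assignment n) (C : Clause n k) → satisfies σ C ≡ true →
               ∀ l → σ (proj₁ (C l)) ≡ proj₂ (C l)
literal-true {k = k} σ C sat l = boolEq-sound _ _ (allFin-elim k _ sat l)

occursWith-sat : ∀ {n k} (σ : Assignment n) (C : Clause n k) → satisfies σ C ≡ true →
                 ∀ i b → σ i ≡ b → occursWith C i b ≡ occurs C i
occursWith-sat {k = k} σ C sat i b σi≡b = anyFin-cong k agree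
  where
  agree : ∀ l → does (proj₁ (C l) F.≟ i) ∧ boolEq (proj₂ (C l)) b ≡ does (proj₁ (C l) F.≟ i)
  agree l with proj₁ (C l) F.≟ i
  ... | yes refl rewrite sym (literal-true σ C sat l) | σi≡b = boolEq-refl b
  ... | no _     = refl

occursWith-opp : ∀ {n k} (σ : Assignment n) (C : Clause n k) → satisfies σ C ≡ true →
                 ∀ i b → σ i ≡ b → occursWith C i (not b) ≡ false
occursWith-opp {k = k} σ C sat i b σi≡b = trans (anyFin-cong k disagree) (anyFin-false k)
  where
  disagree : ∀ l → does (proj₁ (C l) F.≟ i) ∧ boolEq (proj₂ (C l)) (not b) ≡ false
  disagree l with proj₁ (C l) F.≟ i
  ... | yes refl rewrite sym (literal-true σ C sat l) | σi≡b = boolEq-not b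
  ... | no _     = refl

sign : Bool → Tri
sign b = if b then pos else neg

indicator : Bool → Tri
indicator b = if b then pos else zer

signed-coeff : ∀ {n m k} .{{_ : NonZero m}} (Φ : Formula n m k) (σ : Assignment n) j →
               satisfies σ (Φ j) ≡ true → ∀ i →
               coeff Φ j i * val (sign (σ i)) ≡ (if occurs (Φ j) i then (+ 1) / m else 0ℚ)
signed-coeff {m = m} Φ σ j sat i with σ i in σi
... | true  rewrite occursWith-sat σ (Φ j) sat i true σi
                  | occursWith-opp σ (Φ j) sat i true σi = *-identityʳ _
... | false rewrite occursWith-sat σ (Φ j) sat i false σi
                  | occursWith-opp σ (Φ j) sat i false σi with occurs (Φ j) i
...   | true  = solve 1 (λ t → (:- t) :* (:- con 1ℚ) := t) refl ((+ 1) / m)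
  where open +-*-Solver
...   | false = *-zeroˡ (- 1ℚ)

row-sum : ∀ {n m k} .{{_ : NonZero m}} (Φ : Formula n m k) → DistinctVars Φ →
          (σ : Assignment n) → ∀ j → satisfies σ (Φ j) ≡ true →
          Σℚ n (λ i → coeff Φ j i * val (sign (σ i))) ≡ ((+ 1) / m) * nq k
row-sum {n} {m} {k} Φ distinct σ j sat = begin
  Σℚ n (λ i → coeff Φ j i * val (sign (σ i)))         ≡⟨ Σ-cong n (signed-coeff Φ σ j sat) ⟩
  Σℚ n (λ i → if occurs (Φ j) i then (+ 1) / m else 0ℚ) ≡⟨ Σ-indicator n (occurs (Φ j)) _ ⟩
  ((+ 1) / m) * nq (count n (occurs (Φ j)))            ≡⟨ cong (λ c → ((+ 1) / m) * nq c)
                                                            (count-image n k _ (distinct j)) ⟩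
  ((+ 1) / m) * nq k                                   ∎
  where open ≡-Reasoning

numerator : ∀ {n m k} .{{_ : NonZero m}} (Φ : Formula n m k) → DistinctVars Φ →
            (σ : Assignment n) →
            thetaNum Φ (λ i → sign (σ i)) (λ j → indicator (satisfies σ (Φ j)))
              ≡ (((+ 1) / m) * nq k) * nq (numSat Φ σ)
numerator {n} {m} {k} Φ distinct σ = begin
  Σℚ n (λ i → Σℚ m (λ j → a j i * g j))     ≡⟨ Σ-swap n m (λ i j → a j i * g j) ⟩
  Σℚ m (λ j → Σℚ n (λ i → a j i * g j))     ≡⟨ Σ-cong m (λ j → Σ-*ʳ n (λ i → a j i) (g j)) ⟩
  Σℚ m (λ j → Σℚ n (λ i → a j i) * g j)     ≡⟨ Σ-cong m (λ j → column j (satisfies σ (Φ j)) refl) ⟩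
  Σℚ m (λ j → if sat j then row else 0ℚ)    ≡⟨ Σ-indicator m sat row ⟩
  row * nq (numSat Φ σ)                     ∎
  where
  open ≡-Reasoning
  a : Fin m → Fin n → ℚ
  a j i = coeff Φ j i * val (sign (σ i))
  sat : Fin m → Bool
  sat j = satisfies σ (Φ j)
  g : Fin m → ℚ
  g j = val (indicator (sat j))
  row : ℚ
  row = ((+ 1) / m) * nq k
  column : ∀ j b → sat j ≡ b → Σℚ n (a j) * val (indicator b) ≡ (if b then row else 0ℚ)
  column j true  s = trans (*-identityʳ _) (row-sum Φ distinct σ j s)
  column j false _ = *-zeroʳ (Σℚ n (a j))

μ-sign : ∀ n .{{_ : NonZero n}} (σ : Assignment n) → μ n (λ i → sign (σ i)) ≡ 1ℚ
μ-sign n σ = trans (cong ((+ 1) / n *_) (trans (Σ-cong n (λ i → unit (σ i))) (Σ-one n)))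
                   (recip-cancel n)
  where
  unit : ∀ b → ∣ val (sign b) ∣ ≡ 1ℚ
  unit true  = refl
  unit false = refl

μ-indicator : ∀ m .{{_ : NonZero m}} (s : Fin m → Bool) →
              μ m (λ j → indicator (s j)) ≡ ((+ 1) / m) * nq (count m s)
μ-indicator m s = cong ((+ 1) / m *_)
  (trans (Σ-cong m (λ j → unit (s j))) (trans (Σ-indicator m s 1ℚ) (*-identityˡ _)))
  where
  unit : ∀ b → ∣ val (indicator b) ∣ ≡ (if b then 1ℚ else 0ℚ)
  unit true  = refl
  unit false = refl

scale-bound : ∀ α M S t .{{_ : NonNegative t}} → t * M ≡ 1ℚ → α * M ≤ S → α ≤ t * S
scale-bound α M S t tM≡1 αM≤S = subst (_≤ t * S) α≡ (*-monoˡ-≤-nonNeg t αM≤S)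
  where
  α≡ : t * (α * M) ≡ α
  α≡ = trans (solve 3 (λ t α M → t :* (α :* M) := α :* (t :* M)) refl t α M)
             (trans (cong (α *_) tM≡1) (*-identityʳ α))
    where open +-*-Solver

average-bound : ∀ h α x .{{_ : NonNegative h}} → α ≤ x → h * (α + x) ≤ (h + h) * x
average-bound h α x α≤x = subst (h * (α + x) ≤_) (sym (*-distribʳ-+ x h h))
  (subst (h * (α + x) ≤_) (*-distribˡ-+ h x x) (*-monoˡ-≤-nonNeg h (+-monoˡ-≤ x α≤x)))

≤-÷ : ∀ h N D .{{_ : Positive D}} → h * D ≤ N → h ≤ (N ÷ D) {{pos⇒nonZero D}}
≤-÷ h N D hD≤N = *-cancelʳ-≤-pos D (subst (h * D ≤_) (sym cancel) hD≤N)
  where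
  cancel : (N ÷ D) {{pos⇒nonZero D}} * D ≡ N
  cancel = trans (*-assoc N _ D)
                 (trans (cong (N *_) (*-inverseˡ D {{pos⇒nonZero D}})) (*-identityʳ N))

-- Lemma 4.2.  The witnesses built from σ give ϑ(f,g) ≥ k/2.
lemma4p2 : (n m k : ℕ) .{{_ : NonZero n}} .{{_ : NonZero m}} (α : ℚ) →
    0ℚ < α → α < 1ℚ →
    (Φ : Formula n m k) → DistinctVars Φ →
    (∃[ σ ] (α * nq m ≤ nq (numSat Φ σ))) →
    ∃[ f ] ∃[ g ] Σ (0ℚ < thetaDen n m α f g) (λ d>0 → (+ k) / 2 ≤ ϑ α Φ f g d>0)
lemma4p2 n m k α 0<α _ Φ distinct (σ , αm≤S) = f , g , den>0 , bound
  where
  f : Fin n → Tri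
  f i = sign (σ i)
  g : Fin m → Tri
  g j = indicator (satisfies σ (Φ j))
  t S h : ℚ
  t = (+ 1) / m
  S = nq (numSat Φ σ)
  h = (+ k) / 2
  instance
    t≥0 : NonNegative t
    t≥0 = normalize-nonNeg 1 m
    h≥0 : NonNegative h
    h≥0 = normalize-nonNeg k 2

  α≤tS : α ≤ t * S
  α≤tS = scale-bound α (nq m) S t (recip-cancel m) αm≤S

  den≡ : thetaDen n m α f g ≡ α + t * S
  den≡ = cong₂ _+_ (trans (cong (α *_) (μ-sign n σ)) (*-identityʳ α)) (μ-indicator m _)

  num≡ : thetaNum Φ f g ≡ (h + h) * (t * S)
  num≡ = trans (numerator Φ distinct σ)
    (trans (solve 3 (λ t K S → (t :* K) :* S := K :* (t :* S)) refl t (nq k) S)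
           (cong (_* (t * S)) (sym (halves k))))
    where open +-*-Solver

  den>0 : 0ℚ < thetaDen n m α f g
  den>0 = subst (0ℚ <_) (sym den≡) (+-mono-<-≤ 0<α (≤-trans (<⇒≤ 0<α) α≤tS))

  bound : h ≤ ϑ α Φ f g den>0
  bound = ≤-÷ h _ _ {{positive den>0}}
    (subst₂ _≤_ (cong (h *_) (sym den≡)) (sym num≡) (average-bound h α (t * S) α≤tS))
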